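{- Let $F$ be a connected, checkerboard coloured, $4$-regular cellularly embedded graph, and let $s$ be any graph state of $F$. Let $B$ (resp. $C$) be the set of edges of the blackface graph $F_{bl}$ corresponding to vertices of $F$ at which $s$ has a black split (resp. a crossing). Then the number of components of $s$ equals $f\big((F_{bl})^{\tau(C)}-B\big)$.
   Context: A checkerboard colouring of $F$ colours its faces black and white so that adjacent faces differ; at each vertex of $F$ the four face-corners alternate black, white, black, white. A vertex state at $v$ pairs the four half-edges at $v$: the black split pairs the two half-edges bounding each black corner; the white split pairs those bounding each white corner; the crossing pairs opposite half-edges. A graph state is a choice of vertex state at every vertex; its components are the resulting closed curves. The blackface graph $F_{bl}$ has a vertex in each black face and, for each vertex $v$ of $F$, an edge through $v$ joining the black faces meeting at $v$; it is viewed as a ribbon graph, with edges corresponding to vertices of $F$. For a ribbon graph $H$ and $C\subseteq E(H)$, $H^{\tau(C)}$ is the ribbon graph obtained by giving each edge in $C$ a half-twist (detach one end of the edge ribbon from its vertex disc, give it a half twist, reattach). $H-B$ is the ribbon graph obtained by deleting the edges in $B$, and $f(\cdot)$ denotes the number of boundary components of a ribbon graph. -}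

module Defs where

open import Data.Nat using (ℕ)
open import Data.Fin using (Fin)
open import Data.Bool using (Bool; true; false; not)
open import Data.Product using (Σ; ∃; _×_; _,_; proj₁; proj₂)
open import Data.Sum using (_⊎_)
open import Relation.Binary.PropositionalEquality using (_≡_; _≢_; refl; sym; trans; cong)
open import Relation.Binary.Construct.Closure.ReflexiveTransitive using (Star)
open import Relation.Binary.Construct.Closure.Symmetric using (SymClosure)

-- Number of connected components of a (finite) graph given by an
-- adjacency relation R on a node type A:  "HasComponents A R k" says
-- that the graph has exactly k connected components, witnessed by a
-- labelling c : A → Fin k that is onto, constant along edges, and
-- identifies only nodes joined by a path.

record HasComponents (A : Set) (R : A → A → Set) (k : ℕ) : Set where
  field
    label    : A → Fin k
    onto     : ∀ i → ∃ λ x → label x ≡ i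
    alongR   : ∀ x y → R x y → label x ≡ label y
    joined   : ∀ x y → label x ≡ label y → Star (SymClosure R) x y

-- Cellularly embedded graphs, as graph-encoded maps (gems) on the
-- finite set of flags Fin n.  A flag is a (vertex, edge, face) incidence
-- triangle;  t0 changes the vertex, t1 changes the edge, t2 changes the
-- face.  Vertices = ⟨t1,t2⟩-orbits, edges = ⟨t0,t2⟩-orbits,
-- faces = ⟨t0,t1⟩-orbits.

record Gem (n : ℕ) : Set where
  field
    t0 t1 t2 : Fin n → Fin n
    t0-inv : ∀ x → t0 (t0 x) ≡ x
    t1-inv : ∀ x → t1 (t1 x) ≡ x
    t2-inv : ∀ x → t2 (t2 x) ≡ x
    t0-fpf : ∀ x → t0 x ≢ x
    t1-fpf : ∀ x → t1 x ≢ x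
    t2-fpf : ∀ x → t2 x ≢ x
    t02-comm : ∀ x → t0 (t2 x) ≡ t2 (t0 x)
    t02-fpf  : ∀ x → t0 (t2 x) ≢ x

module _ {n : ℕ} (F : Gem n) where
  open Gem F

  Step : Fin n → Fin n → Set
  Step x y = (y ≡ t0 x) ⊎ (y ≡ t1 x) ⊎ (y ≡ t2 x)

  Connected : Set
  Connected = ∀ x y → Star Step x y

  -- rotation around a vertex by one half-edge
  rot : Fin n → Fin n
  rot x = t1 (t2 x)

  -- every vertex has degree exactly 4 (⟨t1 t2⟩ has orbits of size 4)
  FourRegular : Set
  FourRegular = ∀ x → (rot (rot (rot (rot x))) ≡ x) × (rot (rot x) ≢ x)

  -- checkerboard colouring: colour of the face of each flag,
  -- true = black, false = white; adjacent faces (across an edge) differ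
  record Checkerboard : Set where
    field
      colour   : Fin n → Bool
      colour-t0 : ∀ x → colour (t0 x) ≡ colour x
      colour-t1 : ∀ x → colour (t1 x) ≡ colour x
      colour-t2 : ∀ x → colour (t2 x) ≡ not (colour x)

data VState : Set where
  blackSplit whiteSplit crossing : VState

module _ {n : ℕ} (F : Gem n) where
  open Gem F

  record GraphState : Set where
    field
      st    : Fin n → VState
      st-t1 : ∀ x → st (t1 x) ≡ st x
      st-t2 : ∀ x → st (t2 x) ≡ st x

  -- The curves of a graph state, as a graph on flags.  A half-edge at v
  -- is a t2-pair {x, t2 x}; an edge joins its two half-edges (t0); the
  -- vertex state pairs half-edges at v:
  --   black split: the two half-edges of each black corner {x, t1 x};
  --   white split: the two half-edges of each white corner {x, t1 x};
  --   crossing:    opposite half-edges (x and t1 (t2 (t1 x))).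
  module _ (χ : Checkerboard F) (s : GraphState) where
    open Checkerboard χ
    open GraphState s

    VertexLink : VState → Fin n → Fin n → Set
    VertexLink blackSplit x y = (colour x ≡ true)  × (y ≡ t1 x)
    VertexLink whiteSplit x y = (colour x ≡ false) × (y ≡ t1 x)
    VertexLink crossing   x y = y ≡ t1 (t2 (t1 x))

    StateAdj : Fin n → Fin n → Set
    StateAdj x y = (y ≡ t2 x) ⊎ (y ≡ t0 x) ⊎ VertexLink (st x) x y

    NumComponents : ℕ → Set
    NumComponents k = HasComponents (Fin n) StateAdj k

-- Ribbon graphs, as gems on an arbitrary flag type (only the three
-- flag involutions are needed for the operations below).
-- Vertex discs = ⟨τ1,τ2⟩-orbits,
-- edge ribbons = ⟨τ0,τ2⟩-orbits, boundary components = ⟨τ0,τ1⟩-orbits.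
-- Edge sets are given as predicates on flags (constant on edges).

record RibbonGraph : Set₁ where
  field
    Flag : Set
    τ0 τ1 τ2 : Flag → Flag

EdgeSet : RibbonGraph → Set
EdgeSet H = RibbonGraph.Flag H → Bool

-- H^{τ(C)}: half-twist every edge in C (partial Petrial: on the flags of
-- edges in C, τ0 is replaced by τ0 ∘ τ2).
twist : (H : RibbonGraph) → EdgeSet H → RibbonGraph
twist H C = record
  { Flag = Flag
  ; τ0 = λ x → if′ C x then τ0 (τ2 x) else τ0 x
  ; τ1 = τ1
  ; τ2 = τ2 }
  where
  open RibbonGraph H
  if′_then_else_ : {A : Set} → Bool → A → A → A
  if′ true  then a else b = a
  if′ false then a else b = b

-- Boundary of H − B, traced on the flags of H: along a vertex disc
-- consecutive flags are joined (τ1); along a kept edge ribbon the two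
-- ends are joined (τ0); where a deleted edge was attached, the arc of
-- the vertex disc between its two flags becomes boundary (τ2).
-- (Vertices left isolated give one boundary circle each.)
BoundaryAdjMinus : (H : RibbonGraph) → EdgeSet H →
                   RibbonGraph.Flag H → RibbonGraph.Flag H → Set
BoundaryAdjMinus H B x y =
  (y ≡ τ1 x) ⊎ ((B x ≡ false) × (y ≡ τ0 x)) ⊎ ((B x ≡ true) × (y ≡ τ2 x))
  where open RibbonGraph H

NumBoundaryMinus : (H : RibbonGraph) → EdgeSet H → ℕ → Set
NumBoundaryMinus H B k = HasComponents (RibbonGraph.Flag H) (BoundaryAdjMinus H B) k

-- The blackface graph F_bl as a ribbon graph.  Its flags are the flags
-- of F lying in black faces; its vertex discs are the black faces
-- (τ1 = t0, τ2 = t1, so ⟨τ1,τ2⟩ = ⟨t0,t1⟩), and its edge through the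
-- vertex v of F consists of the four black flags at v, τ0 = t2 ∘ t1 ∘ t2
-- moving from a black corner at v to the opposite black corner on the
-- same side of the ribbon.

module _ {n : ℕ} (F : Gem n) (χ : Checkerboard F) where
  open Gem F
  open Checkerboard χ

  BlackFlag : Set
  BlackFlag = Σ (Fin n) (λ x → colour x ≡ true)

  private
    c212 : ∀ x → colour (t2 (t1 (t2 x))) ≡ colour x
    c212 x = trans (colour-t2 (t1 (t2 x)))
               (trans (cong not (colour-t1 (t2 x)))
                 (trans (cong not (colour-t2 x)) (notnot (colour x))))
      where
      notnot : ∀ b → not (not b) ≡ b
      notnot true = refl
      notnot false = refl

  blackface : RibbonGraph
  blackface = record
    { Flag = BlackFlag
    ; τ0 = λ { (x , p) → t2 (t1 (t2 x)) , trans (c212 x) p }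
    ; τ1 = λ { (x , p) → t0 x , trans (colour-t0 x) p }
    ; τ2 = λ { (x , p) → t1 x , trans (colour-t1 x) p } }

  module _ (s : GraphState F) where
    open GraphState s

    isBlackSplit : VState → Bool
    isBlackSplit blackSplit = true
    isBlackSplit _ = false

    isCrossing : VState → Bool
    isCrossing crossing = true
    isCrossing _ = false

    B-edges : EdgeSet blackface
    B-edges (x , _) = isBlackSplit (st x)

    C-edges : EdgeSet blackface
    C-edges (x , _) = isCrossing (st x)

-- Both sides are "number of connected components" of a relation on flags:
-- the curves of s live on all flags of F, the boundary of (F_bl)^τ(C) − B on
-- the black flags.  Every half-edge {x, t2 x} of F contains exactly one black
-- flag, and the two graphs simulate each other: a boundary step between black
-- flags is a short path along the curves of s, and a curve step between two
-- half-edges is a (possibly empty) boundary step between their black flags.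
module Submission where

open import Data.Nat using (ℕ; zero; suc)
open import Data.Fin using (Fin; punchOut; punchIn; _≟_)
open import Data.Fin.Properties
  using (¬Fin0; punchOut-cong; punchOut-injective; punchOut-punchIn; punchInᵢ≢i)
open import Data.Bool using (Bool; true; false; not)
import Data.Bool as Bool
open import Data.List using (List; []; _∷_; filter; cartesianProduct; allFin)
open import Data.List.Membership.Propositional using (_∈_)
open import Data.List.Membership.Propositional.Properties
  using (∈-filter⁺; ∈-filter⁻; ∈-cartesianProduct⁺; ∈-allFin)
open import Data.List.Relation.Unary.Any using (here; there)
open import Data.Product using (∃; _×_; _,_; proj₁; proj₂)
open import Data.Product.Properties using (,-injective)
open import Data.Sum using (_⊎_; inj₁; inj₂)
open import Data.Empty using (⊥-elim)
open import Function using (_∘_)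
open import Relation.Nullary using (Dec; yes; no)
open import Relation.Nullary.Decidable using (_×-dec_; _⊎-dec_)
open import Relation.Binary.Core using (_⇒_; _=[_]⇒_)
open import Relation.Binary.Definitions using (Decidable)
open import Relation.Binary.PropositionalEquality
  using (_≡_; _≢_; refl; sym; trans; cong; subst; subst₂; isEquivalence)
open import Relation.Binary.Construct.Union using (_∪_)
open import Relation.Binary.Construct.Closure.ReflexiveTransitive using (ε; _◅_; _◅◅_)
open import Relation.Binary.Construct.Closure.Symmetric using (fwd; bwd)
open import Relation.Binary.Construct.Closure.Equivalence as EqClosure
  using (EqClosure; gfold; gmap; join)
open import Axiom.UniquenessOfIdentityProofs using (module Decidable⇒UIP)

open import Defs

private
  variable
    A B : Set
    R S : A → A → Set
    k : ℕ

open HasComponents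

label-along-path : (c : HasComponents A R k) → EqClosure R ⇒ λ x y → label c x ≡ label c y
label-along-path c = gfold isEquivalence (label c) (alongR c _ _)

components-resp : R ⇒ S → S ⇒ R → HasComponents A R k → HasComponents A S k
components-resp R⇒S S⇒R c = record
  { label  = label c
  ; onto   = onto c
  ; alongR = λ x y → alongR c x y ∘ S⇒R
  ; joined = λ x y → EqClosure.map R⇒S ∘ joined c x y }

components-transfer : (f : B → A) (g : A → B) →
  S =[ f ]⇒ EqClosure R → R =[ g ]⇒ EqClosure S →
  (∀ x → EqClosure R (f (g x)) x) → (∀ z → EqClosure S (g (f z)) z) →
  HasComponents A R k → HasComponents B S k
components-transfer f g S⇒R R⇒S fg≈id gf≈id c = record
  { label  = label c ∘ f
  ; onto   = λ i → let (x , lx≡i) = onto c i in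
               g x , trans (label-along-path c (fg≈id x)) lx≡i
  ; alongR = λ z w → label-along-path c ∘ S⇒R
  ; joined = λ z w lz≡lw →
      EqClosure.symmetric _ (gf≈id z)
        ◅◅ join (gmap g R⇒S (joined c (f z) (f w) lz≡lw))
        ◅◅ gf≈id w }

-- Collapsing label p onto label q ≢ p: a surjection Fin (suc k) → Fin k whose
-- only identification is p with q.
module Collapse {k : ℕ} {p q : Fin (suc k)} (q≢p : q ≢ p) where

  redirect : Fin (suc k) → Fin (suc k)
  redirect i with i ≟ p
  ... | yes _ = q
  ... | no  _ = i

  redirect-p : redirect p ≡ q
  redirect-p with p ≟ p
  ... | yes _   = refl
  ... | no  p≢p = ⊥-elim (p≢p refl)

  redirect-other : ∀ {i} → i ≢ p → redirect i ≡ i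
  redirect-other {i} i≢p with i ≟ p
  ... | yes i≡p = ⊥-elim (i≢p i≡p)
  ... | no  _   = refl

  redirect-avoids-p : ∀ i → p ≢ redirect i
  redirect-avoids-p i with i ≟ p
  ... | yes _   = q≢p ∘ sym
  ... | no  i≢p = i≢p ∘ sym

  redirect-kernel : ∀ i j → redirect i ≡ redirect j →
    i ≡ j ⊎ (i ≡ p × j ≡ q) ⊎ (i ≡ q × j ≡ p)
  redirect-kernel i j e with i ≟ p | j ≟ p
  ... | yes refl | yes refl = inj₁ refl
  ... | yes refl | no  _    = inj₂ (inj₁ (refl , sym e))
  ... | no  _    | yes refl = inj₂ (inj₂ (e , refl))
  ... | no  _    | no  _    = inj₁ e

  -- the image of redirect misses p, so it can be renumbered into Fin k
  collapse : Fin (suc k) → Fin k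
  collapse i = punchOut (redirect-avoids-p i)

  collapse-merges : collapse q ≡ collapse p
  collapse-merges = punchOut-cong p (trans (redirect-other q≢p) (sym redirect-p))

  collapse-onto : ∀ j → ∃ λ i → collapse i ≡ j
  collapse-onto j = punchIn p j ,
    trans (punchOut-cong p (redirect-other (punchInᵢ≢i p j))) (punchOut-punchIn p)

  collapse-kernel : ∀ i j → collapse i ≡ collapse j →
    i ≡ j ⊎ (i ≡ p × j ≡ q) ⊎ (i ≡ q × j ≡ p)
  collapse-kernel i j =
    redirect-kernel i j ∘ punchOut-injective (redirect-avoids-p i) (redirect-avoids-p j)

Edge : A → A → A → A → Set
Edge a b x y = (x ≡ a) × (y ≡ b)

components-link-within : (c : HasComponents A R k) {a b : A} →
  label c a ≡ label c b → HasComponents A (R ∪ Edge a b) k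
components-link-within {R = R} c la≡lb = record
  { label  = label c
  ; onto   = onto c
  ; alongR = along
  ; joined = λ x y → EqClosure.map inj₁ ∘ joined c x y }
  where
  along : ∀ x y → (R ∪ Edge _ _) x y → label c x ≡ label c y
  along x y (inj₁ r)             = alongR c x y r
  along x y (inj₂ (refl , refl)) = la≡lb

components-link-across : (c : HasComponents A R (suc k)) {a b : A} →
  label c a ≢ label c b → HasComponents A (R ∪ Edge a b) k
components-link-across {A = A} {R = R} c {a} {b} la≢lb = record
  { label  = collapse ∘ label c
  ; onto   = λ j → let (i , ci≡j) = collapse-onto j ; (x , lx≡i) = onto c i in
               x , trans (cong collapse lx≡i) ci≡j
  ; alongR = along
  ; joined = joined' }
  where
  open Collapse la≢lb
  R⁺ : A → A → Set
  R⁺ = R ∪ Edge a b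
  old : ∀ {x y} → label c x ≡ label c y → EqClosure R⁺ x y
  old {x} {y} = EqClosure.map inj₁ ∘ joined c x y
  along : ∀ x y → R⁺ x y → collapse (label c x) ≡ collapse (label c y)
  along x y (inj₁ r)             = cong collapse (alongR c x y r)
  along x y (inj₂ (refl , refl)) = collapse-merges
  joined' : ∀ x y → collapse (label c x) ≡ collapse (label c y) → EqClosure R⁺ x y
  joined' x y e with collapse-kernel (label c x) (label c y) e
  ... | inj₁ lx≡ly                 = old lx≡ly
  ... | inj₂ (inj₁ (lx≡lb , ly≡la)) = old lx≡lb ◅◅ bwd (inj₂ (refl , refl)) ◅ old (sym ly≡la)
  ... | inj₂ (inj₂ (lx≡la , ly≡lb)) = old lx≡la ◅◅ fwd (inj₂ (refl , refl)) ◅ old (sym ly≡lb)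

Listed : ∀ {n} → List (Fin n × Fin n) → Fin n → Fin n → Set
Listed L x y = (x , y) ∈ L

listed-cons⁺ : ∀ {n} {a b : Fin n} {L} → (Listed L ∪ Edge a b) ⇒ Listed ((a , b) ∷ L)
listed-cons⁺ (inj₁ r)             = there r
listed-cons⁺ (inj₂ (refl , refl)) = here refl

listed-cons⁻ : ∀ {n} {a b : Fin n} {L} → Listed ((a , b) ∷ L) ⇒ (Listed L ∪ Edge a b)
listed-cons⁻ (here e)  = inj₂ (,-injective e)
listed-cons⁻ (there r) = inj₁ r

-- Every finite list of edges on Fin n has a component count: start from the
-- discrete graph and add the edges one at a time.
components-of-list : ∀ {n} (L : List (Fin n × Fin n)) →
  ∃ λ k → HasComponents (Fin n) (Listed L) k
components-of-list {n} [] = n , record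
  { label = λ x → x ; onto = λ i → i , refl ; alongR = λ _ _ () ; joined = λ { x .x refl → ε } }
components-of-list ((a , b) ∷ L) with components-of-list L
... | k , c with label c a ≟ label c b
...   | yes la≡lb = k , components-resp listed-cons⁺ listed-cons⁻ (components-link-within c la≡lb)
...   | no  la≢lb with k
...     | zero   = ⊥-elim (¬Fin0 (label c a))
...     | suc k′ = k′ , components-resp listed-cons⁺ listed-cons⁻ (components-link-across c la≢lb)

-- Every decidable relation on Fin n has a component count: list its edges.
components-of-decidable : ∀ {n} (R : Fin n → Fin n → Set) → Decidable R →
  ∃ λ k → HasComponents (Fin n) R k
components-of-decidable {n} R R? =
  let (k , c) = components-of-list edges in k , components-resp listed⇒R R⇒listed c
  where
  R?′ : (xy : Fin n × Fin n) → Dec (R (proj₁ xy) (proj₂ xy))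
  R?′ (x , y) = R? x y
  edges : List (Fin n × Fin n)
  edges = filter R?′ (cartesianProduct (allFin n) (allFin n))
  listed⇒R : Listed edges ⇒ R
  listed⇒R r = proj₂ (∈-filter⁻ R?′ {xs = cartesianProduct (allFin n) (allFin n)} r)
  R⇒listed : R ⇒ Listed edges
  R⇒listed {x} {y} r = ∈-filter⁺ R?′ (∈-cartesianProduct⁺ (∈-allFin x) (∈-allFin y)) r

twist-τ0-twisted : (H : RibbonGraph) (C : EdgeSet H) (z : RibbonGraph.Flag H) →
  C z ≡ true → RibbonGraph.τ0 (twist H C) z ≡ RibbonGraph.τ0 H (RibbonGraph.τ2 H z)
twist-τ0-twisted H C z Cz rewrite Cz = refl

twist-τ0-untwisted : (H : RibbonGraph) (C : EdgeSet H) (z : RibbonGraph.Flag H) →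
  C z ≡ false → RibbonGraph.τ0 (twist H C) z ≡ RibbonGraph.τ0 H z
twist-τ0-untwisted H C z Cz rewrite Cz = refl

module StateVersusBoundary {n : ℕ} (F : Gem n) (χ : Checkerboard F) (s : GraphState F) where
  open Gem F
  open Checkerboard χ
  open GraphState s

  Curve : Fin n → Fin n → Set
  Curve = StateAdj F χ s

  Fbl^τC : RibbonGraph
  Fbl^τC = twist (blackface F χ) (C-edges F χ s)

  Boundary : BlackFlag F χ → BlackFlag F χ → Set
  Boundary = BoundaryAdjMinus Fbl^τC (B-edges F χ s)

  τ0ᴴ : BlackFlag F χ → BlackFlag F χ
  τ0ᴴ = RibbonGraph.τ0 Fbl^τC

  isB : VState → Bool
  isB = isBlackSplit F χ s

  isC : VState → Bool
  isC = isCrossing F χ s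

  -- the half-edge opposite to x at its vertex, as in the crossing state
  opposite : Fin n → Fin n
  opposite x = t1 (t2 (t1 x))

  opposite-involutive : ∀ x → opposite (opposite x) ≡ x
  opposite-involutive x =
    trans (cong (t1 ∘ t2) (t1-inv (t2 (t1 x)))) (trans (cong t1 (t2-inv (t1 x))) (t1-inv x))

  st-opposite : ∀ x → st (opposite x) ≡ st x
  st-opposite x = trans (st-t1 (t2 (t1 x))) (trans (st-t2 (t1 x)) (st-t1 x))

  colour-opposite : ∀ x → colour (opposite x) ≡ not (colour x)
  colour-opposite x =
    trans (colour-t1 (t2 (t1 x))) (trans (colour-t2 (t1 x)) (cong not (colour-t1 x)))

  t2-of-white : ∀ {x} → colour x ≡ false → colour (t2 x) ≡ true
  t2-of-white {x} white = trans (colour-t2 x) (cong not white)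

  t2-of-black : ∀ {x} → colour x ≡ true → colour (t2 x) ≡ false
  t2-of-black {x} black = trans (colour-t2 x) (cong not black)

  blackFlag-≡ : (z w : BlackFlag F χ) → proj₁ z ≡ proj₁ w → z ≡ w
  blackFlag-≡ (x , p) (.x , q) refl = cong (x ,_) (Decidable⇒UIP.≡-irrelevant Bool._≟_ p q)

  τ0ᴴ-crossing : ∀ z → st (proj₁ z) ≡ crossing → proj₁ (τ0ᴴ z) ≡ t2 (opposite (proj₁ z))
  τ0ᴴ-crossing z eq =
    cong proj₁ (twist-τ0-twisted (blackface F χ) (C-edges F χ s) z (cong isC eq))

  τ0ᴴ-split : ∀ z → isC (st (proj₁ z)) ≡ false → proj₁ (τ0ᴴ z) ≡ t2 (t1 (t2 (proj₁ z)))
  τ0ᴴ-split z notC = cong proj₁ (twist-τ0-untwisted (blackface F χ) (C-edges F χ s) z notC)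

  data OnHalfEdge (x : Fin n) (z : BlackFlag F χ) : Set where
    itself  : proj₁ z ≡ x    → OnHalfEdge x z
    partner : proj₁ z ≡ t2 x → OnHalfEdge x z

  halfEdge-unique : ∀ {x} (z w : BlackFlag F χ) → OnHalfEdge x z → OnHalfEdge x w → z ≡ w
  halfEdge-unique z w (itself e)  (itself e′)  = blackFlag-≡ z w (trans e (sym e′))
  halfEdge-unique z w (partner e) (partner e′) = blackFlag-≡ z w (trans e (sym e′))
  halfEdge-unique (x , black) (_ , black′) (itself refl) (partner refl)
    with () ← trans (sym black′) (t2-of-black black)
  halfEdge-unique (_ , black′) (x , black) (partner refl) (itself refl)
    with () ← trans (sym black′) (t2-of-black black)

  blackOf : ∀ x b → colour x ≡ b → BlackFlag F χ
  blackOf x true  black = x , black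
  blackOf x false white = t2 x , t2-of-white white

  blackOf-on : ∀ x b (e : colour x ≡ b) → OnHalfEdge x (blackOf x b e)
  blackOf-on x true  _ = itself refl
  blackOf-on x false _ = partner refl

  halfEdgeBlack : Fin n → BlackFlag F χ
  halfEdgeBlack x = blackOf x (colour x) refl

  halfEdgeBlack-on : ∀ x → OnHalfEdge x (halfEdgeBlack x)
  halfEdgeBlack-on x = blackOf-on x (colour x) refl

  halfEdgeBlack-proj : ∀ z → EqClosure Boundary (halfEdgeBlack (proj₁ z)) z
  halfEdgeBlack-proj z =
    subst (λ u → EqClosure Boundary u z)
          (halfEdge-unique z _ (itself refl) (halfEdgeBlack-on (proj₁ z))) ε

  halfEdge-path : ∀ {x z} → OnHalfEdge x z → EqClosure Curve (proj₁ z) x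
  halfEdge-path (itself refl) = ε
  halfEdge-path (partner e)   = bwd (inj₁ e) ◅ ε

  joinHalfEdges : ∀ {x y} (z w : BlackFlag F χ) → OnHalfEdge x z → OnHalfEdge y w →
    EqClosure Boundary z w → EqClosure Boundary (halfEdgeBlack x) (halfEdgeBlack y)
  joinHalfEdges {x} {y} z w onz onw =
    subst₂ (EqClosure Boundary) (halfEdge-unique z _ onz (halfEdgeBlack-on x))
                                (halfEdge-unique w _ onw (halfEdgeBlack-on y))

  link : ∀ {x y v} → st x ≡ v → VertexLink F χ s v x y → Curve x y
  link {x} {y} eq l = inj₂ (inj₂ (subst (λ v → VertexLink F χ s v x y) (sym eq) l))

  -- Following a kept edge ribbon of (F_bl)^τ(C) from a black flag x reaches
  -- the far side of the vertex of x; the curve of s gets there as well,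
  -- through the white corner (white split) or straight across (crossing).
  alongRibbon : ∀ x (black : colour x ≡ true) → isB (st x) ≡ false →
    EqClosure Curve x (proj₁ (τ0ᴴ (x , black)))
  alongRibbon x black kept with st x in eq
  ... | blackSplit with () ← kept
  ... | whiteSplit =
    fwd (inj₁ refl) ◅ fwd (link (trans (st-t2 x) eq) (t2-of-black black , refl)) ◅ fwd (inj₁ refl) ◅ ε
  ... | crossing = fwd (link eq refl) ◅ fwd (inj₁ refl) ◅ ε

  -- Where an edge of F_bl is deleted, the boundary turns around the black
  -- corner, exactly as the black split does.
  aroundCorner : ∀ x (black : colour x ≡ true) → isB (st x) ≡ true → EqClosure Curve x (t1 x)
  aroundCorner x black deleted with st x in eq
  ... | blackSplit = fwd (link eq (black , refl)) ◅ ε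
  ... | whiteSplit with () ← deleted
  ... | crossing   with () ← deleted

  boundary⇒curve : Boundary ⇒ λ z w → EqClosure Curve (proj₁ z) (proj₁ w)
  boundary⇒curve (inj₁ refl)                                = fwd (inj₂ (inj₁ refl)) ◅ ε
  boundary⇒curve {x , black} (inj₂ (inj₁ (kept , refl)))    = alongRibbon x black kept
  boundary⇒curve {x , black} (inj₂ (inj₂ (deleted , refl))) = aroundCorner x black deleted

  onHalfEdge-t2 : ∀ {x z} → OnHalfEdge x z → OnHalfEdge (t2 x) z
  onHalfEdge-t2 {x} (itself e)  = partner (trans e (sym (t2-inv x)))
  onHalfEdge-t2     (partner e) = itself e

  -- the vertex discs of F_bl are the black faces: τ1 = t0, which commutes with t2
  onHalfEdge-t0 : ∀ {x z} → OnHalfEdge x z → OnHalfEdge (t0 x) (RibbonGraph.τ1 Fbl^τC z)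
  onHalfEdge-t0     (itself refl)  = itself refl
  onHalfEdge-t0 {x} (partner refl) = partner (t02-comm x)

  -- A crossing from x to its opposite half-edge is the twisted edge ribbon at
  -- that vertex, traversed from whichever of the two half-edges is black.
  crossingAcross : ∀ x → st x ≡ crossing → ∀ b → colour x ≡ b →
    EqClosure Boundary (halfEdgeBlack x) (halfEdgeBlack (opposite x))
  crossingAcross x eq true black =
    joinHalfEdges z (τ0ᴴ z) (itself refl) (partner (τ0ᴴ-crossing z eq))
      (fwd (inj₂ (inj₁ (cong isB eq , refl))) ◅ ε)
    where
    z : BlackFlag F χ
    z = x , black
  crossingAcross x eq false white =
    joinHalfEdges (τ0ᴴ w) w
      (partner (trans (τ0ᴴ-crossing w eq′) (cong t2 (opposite-involutive x)))) (itself refl)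
      (bwd (inj₂ (inj₁ (cong isB eq′ , refl))) ◅ ε)
    where
    eq′ : st (opposite x) ≡ crossing
    eq′ = trans (st-opposite x) eq
    w : BlackFlag F χ
    w = opposite x , trans (colour-opposite x) (cong not white)

  linkAcross : ∀ {x y} v → st x ≡ v → VertexLink F χ s v x y →
    EqClosure Boundary (halfEdgeBlack x) (halfEdgeBlack y)
  linkAcross {x} blackSplit eq (black , refl) =
    joinHalfEdges z (RibbonGraph.τ2 Fbl^τC z) (itself refl) (itself refl)
      (fwd (inj₂ (inj₂ (cong isB eq , refl))) ◅ ε)
    where
    z : BlackFlag F χ
    z = x , black
  linkAcross {x} whiteSplit eq (white , refl) =
    joinHalfEdges z (τ0ᴴ z)
      (partner refl) (partner (trans (τ0ᴴ-split z (cong isC eq′)) (cong (t2 ∘ t1) (t2-inv x))))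
      (fwd (inj₂ (inj₁ (cong isB eq′ , refl))) ◅ ε)
    where
    eq′ : st (t2 x) ≡ whiteSplit
    eq′ = trans (st-t2 x) eq
    z : BlackFlag F χ
    z = t2 x , t2-of-white white
  linkAcross {x} crossing eq refl = crossingAcross x eq (colour x) refl

  curve⇒boundary : Curve =[ halfEdgeBlack ]⇒ EqClosure Boundary
  curve⇒boundary {x} (inj₁ refl) =
    joinHalfEdges (halfEdgeBlack x) (halfEdgeBlack x)
      (halfEdgeBlack-on x) (onHalfEdge-t2 (halfEdgeBlack-on x)) ε
  curve⇒boundary {x} (inj₂ (inj₁ refl)) =
    joinHalfEdges z (RibbonGraph.τ1 Fbl^τC z) (halfEdgeBlack-on x) (onHalfEdge-t0 (halfEdgeBlack-on x))
      (fwd (inj₁ refl) ◅ ε)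
    where
    z : BlackFlag F χ
    z = halfEdgeBlack x
  curve⇒boundary {x} (inj₂ (inj₂ l)) = linkAcross (st x) refl l

  -- the curve relation is decidable, so it has a component count
  curve? : Decidable Curve
  curve? x y = (y ≟ t2 x) ⊎-dec ((y ≟ t0 x) ⊎-dec link? (st x))
    where
    link? : ∀ v → Dec (VertexLink F χ s v x y)
    link? blackSplit = (colour x Bool.≟ true)  ×-dec (y ≟ t1 x)
    link? whiteSplit = (colour x Bool.≟ false) ×-dec (y ≟ t1 x)
    link? crossing   = y ≟ opposite x

proposition6p6 : ∀ {n : ℕ} (F : Gem n) → Connected F → FourRegular F →
    (χ : Checkerboard F) (s : GraphState F) →
    ∃ λ k → NumComponents F χ s k ×
            NumBoundaryMinus (twist (blackface F χ) (C-edges F χ s)) (B-edges F χ s) k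
proposition6p6 F _ _ χ s =
  let (k , curves) = components-of-decidable Curve curve? in
  k , curves ,
  components-transfer proj₁ halfEdgeBlack boundary⇒curve curve⇒boundary
    (λ x → halfEdge-path (halfEdgeBlack-on x)) halfEdgeBlack-proj curves
  where open StateVersusBoundary F χ s
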